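{- Let $k\geq 2$ be an integer and $p'=\lfloor k/2\rfloor-1$. If $n$ is sufficiently large compared to $m$, then $\mathrm{ex}(m,n;P_k)\leq \max\{m,\ p'(m+n-1)\}$.
   Context: $P_k$ denotes the path on $k$ vertices. For a graph $H$, $\mathrm{ex}(m,n;H)$ (the bipartite Turán number) is the maximum number of edges in a bipartite graph $G=(X,Y;E)$ with $|X|=m$, $|Y|=n$ (and $m\le n$) that contains no subgraph isomorphic to $H$. All graphs are finite, simple and undirected. -}

module Defs where

open import Data.Nat using (ℕ; zero; suc; _+_)
open import Data.Bool using (Bool; true; false; T)
open import Data.Fin using (Fin; toℕ)
open import Data.List using (List; map; allFin)
open import Data.Nat.ListAction using (sum)
open import Data.Sum using (_⊎_; inj₁; inj₂)
open import Data.Empty using (⊥)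
open import Data.Product using (Σ; _×_)
open import Function.Definitions using (Injective)
open import Relation.Binary.PropositionalEquality using (_≡_)

-- A bipartite graph G = (X, Y; E) with X = Fin m, Y = Fin n, given by its
-- biadjacency matrix: E i j = true iff x_i y_j is an edge.
BipGraph : ℕ → ℕ → Set
BipGraph m n = Fin m → Fin n → Bool

Vertex : ℕ → ℕ → Set
Vertex m n = Fin m ⊎ Fin n

Adj : ∀ {m n} → BipGraph m n → Vertex m n → Vertex m n → Set
Adj E (inj₁ i) (inj₂ j) = T (E i j)
Adj E (inj₂ j) (inj₁ i) = T (E i j)
Adj E (inj₁ _) (inj₁ _) = ⊥
Adj E (inj₂ _) (inj₂ _) = ⊥

indicator : Bool → ℕ
indicator true = 1
indicator false = 0

edgeCount : ∀ {m n} → BipGraph m n → ℕ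
edgeCount {m} {n} E =
  sum (map (λ i → sum (map (λ j → indicator (E i j)) (allFin n))) (allFin m))

-- G contains a (not necessarily induced) subgraph isomorphic to P_k:
-- k distinct vertices v_0, …, v_{k-1} with v_i adjacent to v_{i+1}.
ContainsPath : ∀ {m n} → ℕ → BipGraph m n → Set
ContainsPath {m} {n} k E =
  Σ (Fin k → Vertex m n) λ f →
    Injective _≡_ _≡_ f ×
    (∀ (i j : Fin k) → suc (toℕ i) ≡ toℕ j → Adj E (f i) (f j))

{-# OPTIONS --safe #-}
-- Let l = ⌊k/2⌋, so that a P_k-free graph has no path on 2l + 1 vertices, and let ν
-- be the number of non-isolated vertices. Induct on ν. A vertex of positive degree
-- at most l - 1 is deleted at the cost of at most l - 1 edges. If there is none, an
-- alternating path of 2l vertices grown greedily closes into a cycle that no edge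
-- leaves, so these 2l vertices span at most l² edges and are deleted together.
-- For l ≥ 3 this yields e ≤ (l - 1)(ν - 1) ≤ (l - 1)(m + n - 1). For l = 2 the
-- blocks are copies of C₄ with e = ν; they use equally many vertices of X and Y,
-- so e ≤ ν - 1 or e ≤ 2νX ≤ 2m, and n > m gives e ≤ m + n - 1. For l = 1 every
-- vertex of X has degree at most one.
module Submission where

open import Defs
open import Data.Bool using (Bool; true; false; T; _∧_; _∨_; not)
open import Data.Bool.Properties using (T-∧; T-∨)
open import Data.Empty using (⊥; ⊥-elim)
open import Data.Fin using (Fin; toℕ; inject≤) renaming (zero to fzero; suc to fsuc)
import Data.Fin.Properties as Fin
open import Data.List using (List; []; _∷_; [_]; length; _++_; map; allFin; tabulate; lookup)
open import Data.List.Membership.Propositional using (_∈_; _∉_)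
open import Data.List.Membership.Propositional.Properties using (∈-lookup; ∈-∃++; ∈-++⁺ʳ)
open import Data.List.Properties using (++-assoc; length-map; map-tabulate)
open import Data.List.Relation.Binary.Permutation.Propositional using (_↭_; ↭-refl; ↭-sym; ↭⇒↭ₛ)
open import Data.List.Relation.Binary.Permutation.Propositional.Properties using (++-comm; ∈-resp-↭; ↭-length)
import Data.List.Relation.Binary.Permutation.Setoid.Properties as Permutationₛ
open import Data.List.Relation.Unary.All as All using ([]; _∷_)
open import Data.List.Relation.Unary.AllPairs using ([]; _∷_)
open import Data.List.Relation.Unary.Any using (here; there)
open import Data.List.Relation.Unary.Unique.Propositional using (Unique)
open import Data.List.Relation.Unary.Unique.Propositional.Properties using (Unique[x∷xs]⇒x∉xs)
open import Data.Nat using (ℕ; zero; suc; _+_; _*_; _∸_; _≤_; _<_; _≥_; _⊔_; z≤n; s≤s; _≟_; _≤?_; _<?_)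
open import Data.Nat.DivMod using (_/_; _%_; m≡m%n+[m/n]*n; m%n<n; m≥n⇒m/n>0)
import Data.Nat.ListAction as ListAction
open import Data.Nat.Properties
open import Algebra.Properties.CommutativeSemigroup +-commutativeSemigroup using (xy∙z≈xz∙y; interchange)
open import Algebra.Properties.Semiring.Sum +-*-semiring
  using (sum; sum-syntax; ∑-distrib-+; sum-cong-≗; sum-replicate-zero; *-distribʳ-sum)
open import Data.Nat.Tactic.RingSolver using (solve-∀)
open import Data.Product using (Σ; ∃; _×_; _,_; proj₁; proj₂)
open import Data.Sum using (_⊎_; inj₁; inj₂)
open import Data.Sum.Properties using (≡-dec; inj₁-injective; inj₂-injective)
open import Data.Unit using (⊤; tt)
open import Function using (_∘_; case_of_)
open import Function.Bundles using (Equivalence)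
open import Relation.Binary.PropositionalEquality hiding ([_])
open import Relation.Nullary using (¬_; Dec; yes; no; does)
open import Relation.Nullary.Decidable using (T?; _×-dec_)

does-sound : ∀ {A : Set} (d : Dec A) → T (does d) → A
does-sound (yes p) _ = p

does-complete : ∀ {A : Set} (d : Dec A) → A → T (does d)
does-complete (yes _) _ = tt
does-complete (no ¬p) p = ¬p p

∧-elimˡ : ∀ {a b} → T (a ∧ b) → T a
∧-elimˡ {true} _ = tt

∧-elimʳ : ∀ {a b} → T (a ∧ b) → T b
∧-elimʳ {true} t = t

T-not⇒¬T : ∀ {b} → T (not b) → ¬ T b
T-not⇒¬T {false} _ ()

¬T⇒T-not : ∀ {b} → ¬ T b → T (not b)
¬T⇒T-not {true}  ¬t = ¬t tt
¬T⇒T-not {false} ¬t = tt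

indicator≤1 : ∀ b → indicator b ≤ 1
indicator≤1 true  = s≤s z≤n
indicator≤1 false = z≤n

indicator-mono : ∀ {a b} → (T a → T b) → indicator a ≤ indicator b
indicator-mono {true}  {true}  h = ≤-refl
indicator-mono {true}  {false} h = ⊥-elim (h tt)
indicator-mono {false}         h = z≤n

indicator>0⇒T : ∀ {b} → 0 < indicator b → T b
indicator>0⇒T {true} _ = tt

sum-mono-≤ : ∀ {n} {f g : Fin n → ℕ} → (∀ i → f i ≤ g i) → sum f ≤ sum g
sum-mono-≤ {zero}  h = z≤n
sum-mono-≤ {suc n} h = +-mono-≤ (h fzero) (sum-mono-≤ (h ∘ fsuc))

sum≤n : ∀ {n} {f : Fin n → ℕ} → (∀ i → f i ≤ 1) → sum f ≤ n
sum≤n {zero}  h = z≤n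
sum≤n {suc n} h = +-mono-≤ (h fzero) (sum≤n (h ∘ fsuc))

sum-zero : ∀ {n} {f : Fin n → ℕ} → (∀ i → f i ≡ 0) → sum f ≡ 0
sum-zero {n} h = trans (sum-cong-≗ h) (sum-replicate-zero n)

term≤sum : ∀ {n} (f : Fin n → ℕ) i → f i ≤ sum f
term≤sum f fzero    = m≤m+n (f fzero) _
term≤sum f (fsuc i) = ≤-trans (term≤sum (f ∘ fsuc) i) (m≤n+m _ (f fzero))

sum>0⇒term>0 : ∀ {n} (f : Fin n → ℕ) → 0 < sum f → ∃ λ i → 0 < f i
sum>0⇒term>0 {suc n} f p with f fzero in eq
... | suc _ = fzero , subst (0 <_) (sym eq) (s≤s z≤n)
... | zero with sum>0⇒term>0 (f ∘ fsuc) p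
...   | i , q = fsuc i , q

sum-supported : ∀ {n} (f : Fin n → ℕ) a → (∀ i → i ≢ a → f i ≡ 0) → sum f ≡ f a
sum-supported {suc n} f fzero    h =
  trans (cong (f fzero +_) (sum-zero (λ i → h (fsuc i) λ ()))) (+-identityʳ _)
sum-supported {suc n} f (fsuc a) h =
  trans (cong (_+ sum (f ∘ fsuc)) (h fzero λ ()))
        (sum-supported (f ∘ fsuc) a (λ i i≢a → h (fsuc i) (i≢a ∘ Fin.suc-injective)))

count : ∀ {n} → (Fin n → Bool) → ℕ
count p = ∑[ i < _ ] indicator (p i)

count≤n : ∀ {n} (p : Fin n → Bool) → count p ≤ n
count≤n p = sum≤n (indicator≤1 ∘ p)

count-mono : ∀ {n} {p q : Fin n → Bool} → (∀ i → T (p i) → T (q i)) → count p ≤ count q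
count-mono h = sum-mono-≤ (λ i → indicator-mono (h i))

count-witness : ∀ {n} (p : Fin n → Bool) → 0 < count p → ∃ λ i → T (p i)
count-witness p c with sum>0⇒term>0 _ c
... | i , q = i , indicator>0⇒T q

witness⇒count>0 : ∀ {n} (p : Fin n → Bool) i → T (p i) → 0 < count p
witness⇒count>0 p i t = ≤-trans (indicator-mono {true} (λ _ → t)) (term≤sum _ i)

count-none : ∀ {n} {p : Fin n → Bool} → (∀ i → ¬ T (p i)) → count p ≡ 0
count-none {p = p} h = sum-zero (λ i → none (p i) (h i))
  where
  none : ∀ b → ¬ T b → indicator b ≡ 0
  none true  ¬t = ⊥-elim (¬t tt)
  none false ¬t = refl

count-split : ∀ {n} (p q : Fin n → Bool) →
  count p ≤ count (λ i → p i ∧ not (q i)) + count (λ i → p i ∧ q i)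
count-split p q = ≤-trans (sum-mono-≤ (λ i → split (p i) (q i)))
  (≤-reflexive (∑-distrib-+ (λ i → indicator (p i ∧ not (q i))) (λ i → indicator (p i ∧ q i))))
  where
  split : ∀ a b → indicator a ≤ indicator (a ∧ not b) + indicator (a ∧ b)
  split true  true  = ≤-refl
  split true  false = ≤-refl
  split false b     = z≤n

count-∨ : ∀ {n} (p q : Fin n → Bool) → count (λ i → p i ∨ q i) ≤ count p + count q
count-∨ p q = ≤-trans (sum-mono-≤ (λ i → ∨-≤ (p i) (q i)))
                      (≤-reflexive (∑-distrib-+ (indicator ∘ p) (indicator ∘ q)))
  where
  ∨-≤ : ∀ a b → indicator (a ∨ b) ≤ indicator a + indicator b
  ∨-≤ true  b = s≤s z≤n
  ∨-≤ false b = ≤-refl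

count-∨-disjoint : ∀ {n} (p q : Fin n → Bool) → (∀ i → T (p i) → ¬ T (q i)) →
  count (λ i → p i ∨ q i) ≡ count p + count q
count-∨-disjoint p q disj = trans (sum-cong-≗ (λ i → ∨-≡ (p i) (q i) (disj i)))
                                  (∑-distrib-+ (indicator ∘ p) (indicator ∘ q))
  where
  ∨-≡ : ∀ a b → (T a → ¬ T b) → indicator (a ∨ b) ≡ indicator a + indicator b
  ∨-≡ true  true  d = ⊥-elim (d tt tt)
  ∨-≡ true  false d = refl
  ∨-≡ false b     d = refl

count-≟ : ∀ {n} (a : Fin n) → count (λ i → does (i Fin.≟ a)) ≡ 1
count-≟ {suc n} fzero    = cong suc (sum-replicate-zero n)
count-≟ {suc n} (fsuc a) = count-≟ a

count≤1⇒unique : ∀ {n} (p : Fin n → Bool) → count p ≤ 1 → ∀ {a a′} → T (p a) → T (p a′) → a ≡ a′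
count≤1⇒unique p c≤1 {a} {a′} pa pa′ with a Fin.≟ a′
... | yes a≡a′ = a≡a′
... | no  a≢a′ = ⊥-elim (1+n≰n (begin
  2                                                   ≡⟨ cong₂ _+_ (count-≟ a) (count-≟ a′) ⟨
  count (λ i → does (i Fin.≟ a)) + count (λ i → does (i Fin.≟ a′))
      ≡⟨ count-∨-disjoint (λ i → does (i Fin.≟ a)) _ disjoint ⟨
  count (λ i → does (i Fin.≟ a) ∨ does (i Fin.≟ a′))   ≤⟨ count-mono into-p ⟩
  count p                                             ≤⟨ c≤1 ⟩
  1                                                   ∎))
  where
  open ≤-Reasoning
  disjoint : ∀ i → T (does (i Fin.≟ a)) → ¬ T (does (i Fin.≟ a′))
  disjoint i i≡a i≡a′ = a≢a′ (trans (sym (does-sound (i Fin.≟ a) i≡a)) (does-sound (i Fin.≟ a′) i≡a′))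
  into-p : ∀ i → T (does (i Fin.≟ a) ∨ does (i Fin.≟ a′)) → T (p i)
  into-p i t with Equivalence.to T-∨ t
  ... | inj₁ i≡a  = subst (T ∘ p) (sym (does-sound (i Fin.≟ a) i≡a)) pa
  ... | inj₂ i≡a′ = subst (T ∘ p) (sym (does-sound (i Fin.≟ a′) i≡a′)) pa′

module _ {n : ℕ} where
  open import Data.List.Membership.DecPropositional (Fin._≟_ {n}) using (_∈?_)

  infix 7 _∈ᵇ_
  _∈ᵇ_ : Fin n → List (Fin n) → Bool
  j ∈ᵇ L = does (j ∈? L)

  ∈ᵇ⇒∈ : ∀ {j L} → T (j ∈ᵇ L) → j ∈ L
  ∈ᵇ⇒∈ {j} {L} = does-sound (j ∈? L)

  ∈⇒∈ᵇ : ∀ {j L} → j ∈ L → T (j ∈ᵇ L)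
  ∈⇒∈ᵇ {j} {L} = does-complete (j ∈? L)

  ∈ᵇ[_] : ∀ a {i} → T (i ∈ᵇ [ a ]) → i ≡ a
  ∈ᵇ[ a ] {i} t with ∈ᵇ⇒∈ {i} {[ a ]} t
  ... | here i≡a = i≡a

  count-∈ᵇ≤length : (L : List (Fin n)) → count (_∈ᵇ L) ≤ length L
  count-∈ᵇ≤length []      = ≤-reflexive (sum-replicate-zero n)
  count-∈ᵇ≤length (a ∷ L) = ≤-trans (count-∨ (λ i → does (i Fin.≟ a)) (_∈ᵇ L))
    (+-mono-≤ (≤-reflexive (count-≟ a)) (count-∈ᵇ≤length L))

  count-∈ᵇ : {L : List (Fin n)} → Unique L → count (_∈ᵇ L) ≡ length L
  count-∈ᵇ {[]}    _          = sum-replicate-zero n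
  count-∈ᵇ {a ∷ L} (a∉ ∷ uL) = begin
    count (_∈ᵇ (a ∷ L))                           ≡⟨ count-∨-disjoint (λ i → does (i Fin.≟ a)) (_∈ᵇ L) disjoint ⟩
    count (λ i → does (i Fin.≟ a)) + count (_∈ᵇ L) ≡⟨ cong₂ _+_ (count-≟ a) (count-∈ᵇ uL) ⟩
    suc (length L)                              ∎
    where
    open ≡-Reasoning
    disjoint : ∀ i → T (does (i Fin.≟ a)) → ¬ T (i ∈ᵇ L)
    disjoint i i≡a i∈L with does-sound (i Fin.≟ a) i≡a
    ... | refl = Unique[x∷xs]⇒x∉xs (a∉ ∷ uL) (∈ᵇ⇒∈ i∈L)

  fresh : (p : Fin n → Bool) (L : List (Fin n)) → length L < count p → ∃ λ j → T (p j) × j ∉ L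
  fresh p L lt = j , ∧-elimˡ t , λ j∈ → T-not⇒¬T (∧-elimʳ t) (∈⇒∈ᵇ j∈)
    where
    outside>0 : 0 < count (λ j → p j ∧ not (j ∈ᵇ L))
    outside>0 = +-cancelʳ-< (length L) 0 _ (≤-trans lt
      (≤-trans (count-split p (_∈ᵇ L)) (+-monoʳ-≤ _
        (≤-trans (count-mono {q = _∈ᵇ L} (λ j → ∧-elimʳ)) (count-∈ᵇ≤length L)))))
    witness = count-witness (λ j → p j ∧ not (j ∈ᵇ L)) outside>0
    j = proj₁ witness
    t = proj₂ witness

  count≥length⇒covers : (p : Fin n → Bool) {L : List (Fin n)} → Unique L → length L ≤ count p →
             (∀ j → T (p j) → j ∈ L) → ∀ {j} → j ∈ L → T (p j)
  count≥length⇒covers p {L} uL L≤p p⊆L {j} j∈L with p j in pj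
  ... | true  = tt
  ... | false = ⊥-elim (m+1+n≰m (count p) (begin
    count p + 1                               ≡⟨ cong (count p +_) (count-≟ j) ⟨
    count p + count (λ i → does (i Fin.≟ j))  ≡⟨ count-∨-disjoint p _ disjoint ⟨
    count (λ i → p i ∨ does (i Fin.≟ j))      ≤⟨ count-mono (λ i → ∈⇒∈ᵇ ∘ into-L i) ⟩
    count (_∈ᵇ L)                             ≡⟨ count-∈ᵇ uL ⟩
    length L                                  ≤⟨ L≤p ⟩
    count p                                   ∎))
    where
    open ≤-Reasoning
    disjoint : ∀ i → T (p i) → ¬ T (does (i Fin.≟ j))
    disjoint i pi i≡j with does-sound (i Fin.≟ j) i≡j
    ... | refl = subst T pj pi
    into-L : ∀ i → T (p i ∨ does (i Fin.≟ j)) → i ∈ L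
    into-L i t with p i in pi
    ... | true  = p⊆L i (subst T (sym pi) tt)
    ... | false with does-sound (i Fin.≟ j) t
    ...   | refl = j∈L

positive : ℕ → Bool
positive zero    = false
positive (suc _) = true

positive⇒0< : ∀ {k} → T (positive k) → 0 < k
positive⇒0< {suc k} _ = s≤s z≤n

0<⇒positive : ∀ {k} → 0 < k → T (positive k)
0<⇒positive {suc k} _ = tt

positive-mono : ∀ {k l} → k ≤ l → T (positive k) → T (positive l)
positive-mono {suc k} {suc l} _ _ = tt

#positive : ∀ {n} → (Fin n → ℕ) → ℕ
#positive f = count (positive ∘ f)

#positive-mono : ∀ {n} {f g : Fin n → ℕ} → (∀ i → f i ≤ g i) → #positive f ≤ #positive g
#positive-mono f≤g = count-mono (λ i → positive-mono (f≤g i))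

#positive-vanish : ∀ {n} {f g : Fin n → ℕ} (q : Fin n → Bool) → (∀ i → f i ≤ g i) →
  (∀ i → T (q i) → f i ≡ 0 × 0 < g i) → #positive f + count q ≤ #positive g
#positive-vanish {f = f} {g} q f≤g vanish = begin
  #positive f + count q                 ≡⟨ count-∨-disjoint (positive ∘ f) q disjoint ⟨
  count (λ i → positive (f i) ∨ q i)    ≤⟨ count-mono into-g ⟩
  #positive g                           ∎
  where
  open ≤-Reasoning
  disjoint : ∀ i → T (positive (f i)) → ¬ T (q i)
  disjoint i fi qi with f i | proj₁ (vanish i qi)
  ... | zero | _ = fi
  into-g : ∀ i → T (positive (f i) ∨ q i) → T (positive (g i))
  into-g i t with positive (f i) in fi
  ... | true  = positive-mono (f≤g i) (subst T (sym fi) tt)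
  ... | false = 0<⇒positive (proj₂ (vanish i t))

#positive-appear : ∀ {n} {f g : Fin n → ℕ} (q : Fin n → Bool) →
  (∀ i → ¬ T (q i) → g i ≤ f i) → #positive g ≤ #positive f + count q
#positive-appear {f = f} {g} q g≤f =
  ≤-trans (count-mono into-f∨q) (count-∨ (positive ∘ f) q)
  where
  into-f∨q : ∀ i → T (positive (g i)) → T (positive (f i) ∨ q i)
  into-f∨q i gi with q i in qi
  ... | true  = Equivalence.from T-∨ (inj₂ tt)
  ... | false = Equivalence.from T-∨ (inj₁ (positive-mono (g≤f i (λ t → subst T qi t)) gi))

module _ {m n : ℕ} where

  degX : BipGraph m n → Fin m → ℕ
  degX E i = count (E i)

  degY : BipGraph m n → Fin n → ℕ
  degY E j = count (λ i → E i j)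

  edges : BipGraph m n → ℕ
  edges E = ∑[ i < m ] degX E i

  νX : BipGraph m n → ℕ
  νX E = #positive (degX E)

  νY : BipGraph m n → ℕ
  νY E = #positive (degY E)

  ν : BipGraph m n → ℕ
  ν E = νX E + νY E

  ν≤m+n : (E : BipGraph m n) → ν E ≤ m + n
  ν≤m+n E = +-mono-≤ (count≤n (positive ∘ degX E)) (count≤n (positive ∘ degY E))

  edge⇒ν≥2 : ∀ (E : BipGraph m n) i j → T (E i j) → 2 ≤ ν E
  edge⇒ν≥2 E i j eij = +-mono-≤ (witness⇒count>0 _ i (0<⇒positive (witness⇒count>0 (E i) j eij)))
                                 (witness⇒count>0 _ j (0<⇒positive (witness⇒count>0 (λ i → E i j) i eij)))

  ν≤0⇒edges≡0 : (E : BipGraph m n) → ν E ≤ 0 → edges E ≡ 0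
  ν≤0⇒edges≡0 E ν≤0 = sum-zero (λ i → count-none (λ j eij → case ≤-trans (edge⇒ν≥2 E i j eij) ν≤0 of λ ()))

  edges>0⇒edge : (E : BipGraph m n) → 0 < edges E → ∃ λ i → ∃ λ j → T (E i j)
  edges>0⇒edge E p with sum>0⇒term>0 (degX E) p
  ... | i , q = i , count-witness (E i) q

  edges≡0⇒νY≡0 : (E : BipGraph m n) → edges E ≡ 0 → νY E ≡ 0
  edges≡0⇒νY≡0 E e≡0 = count-none isolated
    where
    isolated : ∀ j → ¬ T (positive (degY E j))
    isolated j pj with count-witness (λ i → E i j) (positive⇒0< pj)
    ... | i , eij = <⇒≱ (≤-trans (witness⇒count>0 (E i) j eij) (term≤sum (degX E) i)) (≤-reflexive e≡0)

  infix 4 _⊆ᴱ_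
  _⊆ᴱ_ : BipGraph m n → BipGraph m n → Set
  E′ ⊆ᴱ E = ∀ i j → T (E′ i j) → T (E i j)

  νX-mono : {E′ E : BipGraph m n} → E′ ⊆ᴱ E → νX E′ ≤ νX E
  νX-mono E′⊆E = #positive-mono (λ i → count-mono (E′⊆E i))

  νY-mono : {E′ E : BipGraph m n} → E′ ⊆ᴱ E → νY E′ ≤ νY E
  νY-mono E′⊆E = #positive-mono (λ j → count-mono (λ i → E′⊆E i j))

sum-allFin : ∀ {n} (f : Fin n → ℕ) → ListAction.sum (map f (allFin n)) ≡ sum f
sum-allFin {n} f = trans (cong ListAction.sum (map-tabulate (λ i → i) f)) (sum-tabulate f)
  where
  sum-tabulate : ∀ {n} (f : Fin n → ℕ) → ListAction.sum (tabulate f) ≡ sum f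
  sum-tabulate {zero}  f = refl
  sum-tabulate {suc n} f = cong (f fzero +_) (sum-tabulate (f ∘ fsuc))

edgeCount≡edges : ∀ {m n} (E : BipGraph m n) → edgeCount E ≡ edges E
edgeCount≡edges E = trans (sum-allFin (λ i → ListAction.sum (map (indicator ∘ E i) (allFin _))))
                          (sum-cong-≗ (λ i → sum-allFin (indicator ∘ E i)))

-- Deleting vertices

module _ {m n : ℕ} where

  delete : List (Fin m) → List (Fin n) → BipGraph m n → BipGraph m n
  delete xs ys E i j = E i j ∧ not (i ∈ᵇ xs ∨ j ∈ᵇ ys)

  crossing : List (Fin m) → List (Fin n) → BipGraph m n → ℕ
  crossing xs ys E = ∑[ i < m ] count (λ j → E i j ∧ (i ∈ᵇ xs ∨ j ∈ᵇ ys))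

  delete-⊆ : ∀ xs ys (E : BipGraph m n) → delete xs ys E ⊆ᴱ E
  delete-⊆ xs ys E i j = ∧-elimˡ

  edges≤delete+crossing : ∀ xs ys (E : BipGraph m n) →
    edges E ≤ edges (delete xs ys E) + crossing xs ys E
  edges≤delete+crossing xs ys E =
    ≤-trans (sum-mono-≤ (λ i → count-split (E i) (λ j → i ∈ᵇ xs ∨ j ∈ᵇ ys)))
            (≤-reflexive (∑-distrib-+ (degX (delete xs ys E)) (λ i → count (λ j → E i j ∧ (i ∈ᵇ xs ∨ j ∈ᵇ ys)))))

  degX-delete : ∀ xs ys (E : BipGraph m n) {i} → T (i ∈ᵇ xs) → degX (delete xs ys E) i ≡ 0
  degX-delete xs ys E {i} i∈ = count-none gone
    where
    gone : ∀ j → ¬ T (E i j ∧ not (i ∈ᵇ xs ∨ j ∈ᵇ ys))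
    gone j t = T-not⇒¬T (∧-elimʳ t) (Equivalence.from T-∨ (inj₁ i∈))

  degY-delete : ∀ xs ys (E : BipGraph m n) {j} → T (j ∈ᵇ ys) → degY (delete xs ys E) j ≡ 0
  degY-delete xs ys E {j} j∈ = count-none gone
    where
    gone : ∀ i → ¬ T (E i j ∧ not (i ∈ᵇ xs ∨ j ∈ᵇ ys))
    gone i t = T-not⇒¬T (∧-elimʳ t) (Equivalence.from (T-∨ {i ∈ᵇ xs}) (inj₂ j∈))

  degY-delete-untouched : ∀ xs ys (E : BipGraph m n) {j} → ¬ T (j ∈ᵇ ys) →
    (∀ i → T (E i j) → ¬ T (i ∈ᵇ xs)) → degY E j ≤ degY (delete xs ys E) j
  degY-delete-untouched xs ys E {j} j∉ far = count-mono kept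
    where
    kept : ∀ i → T (E i j) → T (E i j ∧ not (i ∈ᵇ xs ∨ j ∈ᵇ ys))
    kept i eij = Equivalence.from T-∧ (eij , ¬T⇒T-not
      (λ t → case Equivalence.to T-∨ t of λ { (inj₁ i∈) → far i eij i∈ ; (inj₂ j∈) → j∉ j∈ }))

  private
    touches : ∀ (E : BipGraph m n) xs ys i j → T (E i j ∧ (i ∈ᵇ xs ∨ j ∈ᵇ ys)) → T (i ∈ᵇ xs) ⊎ T (j ∈ᵇ ys)
    touches E xs ys i j = Equivalence.to T-∨ ∘ ∧-elimʳ

  crossing-[X] : ∀ a (E : BipGraph m n) → crossing [ a ] [] E ≤ degX E a
  crossing-[X] a E = begin
    crossing [ a ] [] E                                ≡⟨ sum-supported _ a (λ i i≢a → count-none (away i i≢a)) ⟩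
    count (λ j → E a j ∧ (a ∈ᵇ [ a ] ∨ j ∈ᵇ []))    ≤⟨ count-mono {q = E a} (λ j → ∧-elimˡ) ⟩
    degX E a                                           ∎
    where
    open ≤-Reasoning
    away : ∀ i → i ≢ a → ∀ j → ¬ T (E i j ∧ (i ∈ᵇ [ a ] ∨ j ∈ᵇ []))
    away i i≢a j t with touches E [ a ] [] i j t
    ... | inj₁ i∈ = i≢a (∈ᵇ[ a ] i∈)

  crossing-[Y] : ∀ b (E : BipGraph m n) → crossing [] [ b ] E ≤ degY E b
  crossing-[Y] b E = sum-mono-≤ row≤
    where
    row≤ : ∀ i → count (λ j → E i j ∧ (i ∈ᵇ [] ∨ j ∈ᵇ [ b ])) ≤ indicator (E i b)
    row≤ i = ≤-trans (≤-reflexive (sum-supported _ b (λ j j≢b → none j j≢b)))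
                     (indicator-mono ∧-elimˡ)
      where
      none : ∀ j → j ≢ b → indicator (E i j ∧ (i ∈ᵇ [] ∨ j ∈ᵇ [ b ])) ≡ 0
      none j j≢b with E i j ∧ (i ∈ᵇ [] ∨ j ∈ᵇ [ b ]) in t
      ... | false = refl
      ... | true with touches E [] [ b ] i j (subst T (sym t) tt)
      ...   | inj₂ j∈ = ⊥-elim (j≢b (∈ᵇ[ b ] j∈))

  Closed : List (Fin m) → List (Fin n) → BipGraph m n → Set
  Closed xs ys E = ∀ i j → T (E i j) → T (i ∈ᵇ xs) ⊎ T (j ∈ᵇ ys) → T (i ∈ᵇ xs) × T (j ∈ᵇ ys)

  crossing-closed : ∀ xs ys (E : BipGraph m n) → Closed xs ys E →
    crossing xs ys E ≤ length xs * length ys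
  crossing-closed xs ys E closed = begin
    crossing xs ys E                                     ≤⟨ sum-mono-≤ row≤ ⟩
    ∑[ i < m ] (count (_∈ᵇ ys) * indicator (i ∈ᵇ xs))
      ≡⟨ sum-cong-≗ (λ i → *-comm (count (_∈ᵇ ys)) (indicator (i ∈ᵇ xs))) ⟩
    ∑[ i < m ] (indicator (i ∈ᵇ xs) * count (_∈ᵇ ys))
      ≡⟨ *-distribʳ-sum (count (_∈ᵇ ys)) (indicator ∘ (_∈ᵇ xs)) ⟨
    count (_∈ᵇ xs) * count (_∈ᵇ ys)
      ≤⟨ *-mono-≤ (count-∈ᵇ≤length xs) (count-∈ᵇ≤length ys) ⟩
    length xs * length ys                                ∎
    where
    open ≤-Reasoning
    entry≤ : ∀ i j → indicator (E i j ∧ (i ∈ᵇ xs ∨ j ∈ᵇ ys)) ≤ indicator (j ∈ᵇ ys) * indicator (i ∈ᵇ xs)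
    entry≤ i j with E i j ∧ (i ∈ᵇ xs ∨ j ∈ᵇ ys) in t
    ... | false = z≤n
    ... | true with closed i j (∧-elimˡ (subst T (sym t) tt))
                                (touches E xs ys i j (subst T (sym t) tt))
    ...   | i∈ , j∈ with i ∈ᵇ xs | j ∈ᵇ ys
    ...     | true | true = ≤-refl
    row≤ : ∀ i → count (λ j → E i j ∧ (i ∈ᵇ xs ∨ j ∈ᵇ ys)) ≤ count (_∈ᵇ ys) * indicator (i ∈ᵇ xs)
    row≤ i = ≤-trans (sum-mono-≤ (entry≤ i))
                     (≤-reflexive (sym (*-distribʳ-sum (indicator (i ∈ᵇ xs)) (indicator ∘ (_∈ᵇ ys)))))

  νX-delete : ∀ {xs} ys (E : BipGraph m n) → Unique xs → (∀ i → T (i ∈ᵇ xs) → 0 < degX E i) →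
    νX (delete xs ys E) + length xs ≤ νX E
  νX-delete {xs} ys E uxs active = begin
    νX (delete xs ys E) + length xs          ≡⟨ cong (νX (delete xs ys E) +_) (count-∈ᵇ uxs) ⟨
    νX (delete xs ys E) + count (_∈ᵇ xs)    ≤⟨ #positive-vanish (_∈ᵇ xs) (λ i → count-mono (delete-⊆ xs ys E i))
                                                  (λ i i∈ → degX-delete xs ys E i∈ , active i i∈) ⟩
    νX E                                     ∎
    where open ≤-Reasoning

  νY-delete : ∀ xs {ys} (E : BipGraph m n) → Unique ys → (∀ j → T (j ∈ᵇ ys) → 0 < degY E j) →
    νY (delete xs ys E) + length ys ≤ νY E
  νY-delete xs {ys} E uys active = begin
    νY (delete xs ys E) + length ys          ≡⟨ cong (νY (delete xs ys E) +_) (count-∈ᵇ uys) ⟨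
    νY (delete xs ys E) + count (_∈ᵇ ys)    ≤⟨ #positive-vanish (_∈ᵇ ys) (λ j → count-mono (λ i → delete-⊆ xs ys E i j))
                                                  (λ j j∈ → degY-delete xs ys E j∈ , active j j∈) ⟩
    νY E                                     ∎
    where open ≤-Reasoning

  deg : BipGraph m n → Vertex m n → ℕ
  deg E (inj₁ i) = degX E i
  deg E (inj₂ j) = degY E j

  infixl 6 _─_
  _─_ : BipGraph m n → Vertex m n → BipGraph m n
  E ─ inj₁ i = delete [ i ] [] E
  E ─ inj₂ j = delete [] [ j ] E

  ─-⊆ : ∀ (E : BipGraph m n) v → E ─ v ⊆ᴱ E
  ─-⊆ E (inj₁ i) = delete-⊆ [ i ] [] E
  ─-⊆ E (inj₂ j) = delete-⊆ [] [ j ] E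

  edges-─ : ∀ (E : BipGraph m n) v → edges E ≤ edges (E ─ v) + deg E v
  edges-─ E (inj₁ i) = ≤-trans (edges≤delete+crossing [ i ] [] E) (+-monoʳ-≤ _ (crossing-[X] i E))
  edges-─ E (inj₂ j) = ≤-trans (edges≤delete+crossing [] [ j ] E) (+-monoʳ-≤ _ (crossing-[Y] j E))

  νX-─ : ∀ (E : BipGraph m n) i → 0 < degX E i → νX (E ─ inj₁ i) + 1 ≤ νX E
  νX-─ E i p = νX-delete [] E ([] ∷ []) (λ i′ i′∈ → subst (λ k → 0 < degX E k) (sym (∈ᵇ[ i ] i′∈)) p)

  νY-─ : ∀ (E : BipGraph m n) j → 0 < degY E j → νY (E ─ inj₂ j) + 1 ≤ νY E
  νY-─ E j p = νY-delete [] E ([] ∷ []) (λ j′ j′∈ → subst (λ k → 0 < degY E k) (sym (∈ᵇ[ j ] j′∈)) p)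

  ν-─ : ∀ (E : BipGraph m n) v → 0 < deg E v → ν (E ─ v) + 1 ≤ ν E
  ν-─ E (inj₁ i) p = begin
    νX (E ─ inj₁ i) + νY (E ─ inj₁ i) + 1     ≡⟨ xy∙z≈xz∙y (νX (E ─ inj₁ i)) _ 1 ⟩
    νX (E ─ inj₁ i) + 1 + νY (E ─ inj₁ i)     ≤⟨ +-mono-≤ (νX-─ E i p) (νY-mono (─-⊆ E (inj₁ i))) ⟩
    νX E + νY E                               ∎
    where open ≤-Reasoning
  ν-─ E (inj₂ j) p = begin
    νX (E ─ inj₂ j) + νY (E ─ inj₂ j) + 1     ≡⟨ +-assoc (νX (E ─ inj₂ j)) _ 1 ⟩
    νX (E ─ inj₂ j) + (νY (E ─ inj₂ j) + 1)   ≤⟨ +-mono-≤ (νX-mono (─-⊆ E (inj₂ j))) (νY-─ E j p) ⟩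
    νX E + νY E                               ∎
    where open ≤-Reasoning

-- Walks and paths

Unique-resp-↭ : ∀ {A : Set} {xs ys : List A} → xs ↭ ys → Unique xs → Unique ys
Unique-resp-↭ {A} xs↭ys = Permutationₛ.Unique-resp-↭ (setoid A) (↭⇒↭ₛ xs↭ys)

module _ {m n : ℕ} (E : BipGraph m n) where

  Walk : List (Vertex m n) → Set
  Walk []            = ⊤
  Walk (_ ∷ [])      = ⊤
  Walk (u ∷ v ∷ vs)  = Adj E u v × Walk (v ∷ vs)

  walk⇒path : (vs : List (Vertex m n)) → Unique vs → Walk vs → ContainsPath (length vs) E
  walk⇒path vs uvs wvs = lookup vs , lookup-injective vs uvs , steps vs wvs
    where
    lookup-injective : ∀ vs → Unique vs → ∀ {i j} → lookup vs i ≡ lookup vs j → i ≡ j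
    lookup-injective (v ∷ vs) _            {fzero}  {fzero}  _  = refl
    lookup-injective (v ∷ vs) (v∉ ∷ _)     {fzero}  {fsuc j} eq = ⊥-elim (All.lookup v∉ (∈-lookup j) eq)
    lookup-injective (v ∷ vs) (v∉ ∷ _)     {fsuc i} {fzero}  eq = ⊥-elim (All.lookup v∉ (∈-lookup i) (sym eq))
    lookup-injective (v ∷ vs) (_ ∷ uvs)    {fsuc i} {fsuc j} eq = cong fsuc (lookup-injective vs uvs eq)
    steps : ∀ vs → Walk vs → ∀ i j → suc (toℕ i) ≡ toℕ j → Adj E (lookup vs i) (lookup vs j)
    steps (u ∷ v ∷ vs) (uv , _) fzero    (fsuc fzero) _  = uv
    steps (u ∷ v ∷ vs) (_ , w)  (fsuc i) (fsuc j)     eq = steps (v ∷ vs) w i j (suc-injective eq)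

  walk-++⁻ : ∀ us w vs → Walk (us ++ w ∷ vs) → Walk (us ++ [ w ]) × Walk (w ∷ vs)
  walk-++⁻ []            w vs wk         = tt , wk
  walk-++⁻ (u ∷ [])      w vs (uw , wk)  = (uw , tt) , wk
  walk-++⁻ (u ∷ u′ ∷ us) w vs (uu′ , wk) with walk-++⁻ (u′ ∷ us) w vs wk
  ... | left , right = (uu′ , left) , right

  walk-++⁺ : ∀ us w vs → Walk (us ++ [ w ]) → Walk (w ∷ vs) → Walk (us ++ w ∷ vs)
  walk-++⁺ []            w vs _          right = right
  walk-++⁺ (u ∷ [])      w vs (uw , _)   right = uw , right
  walk-++⁺ (u ∷ u′ ∷ us) w vs (uu′ , left) right = uu′ , walk-++⁺ (u′ ∷ us) w vs left right

  walk-prefix : ∀ us vs → Walk (us ++ vs) → Walk us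
  walk-prefix []            vs _          = tt
  walk-prefix (u ∷ [])      vs _          = tt
  walk-prefix (u ∷ u′ ∷ us) vs (uu′ , wk) = uu′ , walk-prefix (u′ ∷ us) vs wk

  rotate : ∀ h vs → Walk ((h ∷ vs) ++ [ h ]) → ∀ {z} → z ∈ h ∷ vs →
    ∃ λ rs → (h ∷ vs) ↭ (z ∷ rs) × Walk (z ∷ rs)
  rotate h vs cyc {z} z∈ with ∈-∃++ z∈
  ... | []      , s , refl = s , ↭-refl , walk-prefix (z ∷ s) [ h ] cyc
  ... | (h ∷ p) , s , refl = s ++ h ∷ p , ++-comm (h ∷ p) (z ∷ s) , rotated
    where
    halves = walk-++⁻ (h ∷ p) z (s ++ [ h ]) (subst Walk (++-assoc (h ∷ p) (z ∷ s) [ h ]) cyc)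
    rotated : Walk (z ∷ s ++ h ∷ p)
    rotated = walk-prefix (z ∷ s ++ h ∷ p) [ z ]
      (subst Walk (sym (++-assoc (z ∷ s) (h ∷ p) [ z ]))
        (walk-++⁺ (z ∷ s) h (p ++ [ z ]) (proj₂ halves) (proj₁ halves)))

  adj⇒deg>0 : ∀ u v → Adj E u v → 0 < deg E u
  adj⇒deg>0 (inj₁ i) (inj₂ j) eij = witness⇒count>0 (E i) j eij
  adj⇒deg>0 (inj₂ j) (inj₁ i) eij = witness⇒count>0 (λ i → E i j) i eij

  ContainsPath-⊆ : ∀ {E′ k} → E′ ⊆ᴱ E → ContainsPath k E′ → ContainsPath k E
  ContainsPath-⊆ E′⊆E (f , f-inj , f-adj) = f , f-inj , λ i j ij → adj-⊆ (f i) (f j) (f-adj i j ij)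
    where
    adj-⊆ : ∀ u v → Adj _ u v → Adj E u v
    adj-⊆ (inj₁ i) (inj₂ j) = E′⊆E i j
    adj-⊆ (inj₂ j) (inj₁ i) = E′⊆E i j

  ContainsPath-≤ : ∀ {k K} → k ≤ K → ContainsPath K E → ContainsPath k E
  ContainsPath-≤ k≤K (f , f-inj , f-adj) =
      f ∘ (λ i → inject≤ i k≤K)
    , (λ eq → Fin.inject≤-injective k≤K k≤K _ _ (f-inj eq))
    , (λ i j ij → f-adj _ _ (trans (cong suc (Fin.toℕ-inject≤ i k≤K)) (trans ij (sym (Fin.toℕ-inject≤ j k≤K)))))

-- Closed blocks

record ClosedBlock {m n : ℕ} (E : BipGraph m n) (l : ℕ) : Set where
  field
    xs        : List (Fin m)
    ys        : List (Fin n)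
    unique-xs : Unique xs
    unique-ys : Unique ys
    length-xs : length xs ≡ l
    length-ys : length ys ≡ l
    closed    : Closed xs ys E
    active-xs : ∀ i → T (i ∈ᵇ xs) → 0 < degX E i
    active-ys : ∀ j → T (j ∈ᵇ ys) → 0 < degY E j

module _ {m n : ℕ} where

  alternate : List (Fin m × Fin n) → List (Vertex m n)
  alternate []            = []
  alternate ((x , y) ∷ R) = inj₁ x ∷ inj₂ y ∷ alternate R

  length-alternate : ∀ R → length (alternate R) ≡ length R + length R
  length-alternate []      = refl
  length-alternate (_ ∷ R) = cong suc (trans (cong suc (length-alternate R)) (sym (+-suc _ _)))

  inj₁∈alternate : ∀ R {i} → inj₁ i ∈ alternate R → i ∈ map proj₁ R
  inj₁∈alternate (_ ∷ R) (here refl)         = here refl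
  inj₁∈alternate (_ ∷ R) (there (there i∈))  = there (inj₁∈alternate R i∈)

  inj₂∈alternate : ∀ R {j} → inj₂ j ∈ alternate R → j ∈ map proj₂ R
  inj₂∈alternate (_ ∷ R) (there (here refl)) = here refl
  inj₂∈alternate (_ ∷ R) (there (there j∈))  = there (inj₂∈alternate R j∈)

  ∈alternate-inj₁ : ∀ R {i} → i ∈ map proj₁ R → inj₁ i ∈ alternate R
  ∈alternate-inj₁ (_ ∷ R) (here refl) = here refl
  ∈alternate-inj₁ (_ ∷ R) (there i∈)  = there (there (∈alternate-inj₁ R i∈))

  ∈alternate-inj₂ : ∀ R {j} → j ∈ map proj₂ R → inj₂ j ∈ alternate R
  ∈alternate-inj₂ (_ ∷ R) (here refl) = there (here refl)
  ∈alternate-inj₂ (_ ∷ R) (there j∈)  = there (there (∈alternate-inj₂ R j∈))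

  Unique-alternate : ∀ R → Unique (map proj₁ R) → Unique (map proj₂ R) → Unique (alternate R)
  Unique-alternate []            _          _          = []
  Unique-alternate ((x , y) ∷ R) (x∉ ∷ uxs) (y∉ ∷ uys) =
    ((λ ()) ∷ All.tabulate (λ v∈ x≡v → All.lookup x∉ (inj₁∈alternate R (subst (_∈ _) (sym x≡v) v∈)) refl))
    ∷ All.tabulate (λ v∈ y≡v → All.lookup y∉ (inj₂∈alternate R (subst (_∈ _) (sym y≡v) v∈)) refl)
    ∷ Unique-alternate R uxs uys

-- Grow an alternating path x_l y_l … x_1 b greedily (degrees ≥ l leave a fresh
-- neighbour at each step). All neighbours of x_l lie on it, else the path extends to
-- 2l + 1 vertices; as there are at least l of them, x_l ~ b and the path closes to a
-- 2l-cycle. Entering the cycle at any vertex gives a path on its 2l vertices, so no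
-- edge leaves the cycle.
module BlockConstruction {m n : ℕ} (E : BipGraph m n) (l : ℕ)
  (no-path : ¬ ContainsPath (suc (l + l)) E)
  (min-deg : ∀ v → 0 < deg E v → l ≤ deg E v)
  (a : Fin m) (b : Fin n) (eab : T (E a b)) where

  open import Data.List.Membership.DecPropositional (≡-dec (Fin._≟_ {m}) (Fin._≟_ {n})) using (_∈?_)

  record Alternating (R : List (Fin m × Fin n)) : Set where
    field
      unique-xs : Unique (map proj₁ R)
      unique-ys : Unique (map proj₂ R)
      walk      : Walk E (alternate R)
      ends-at-b : ∃ λ q → alternate R ≡ q ++ [ inj₂ b ]

  extend : ∀ x y R → Alternating ((x , y) ∷ R) → suc (length R) < l →
    ∃ λ x′ → ∃ λ y′ → Alternating ((x′ , y′) ∷ (x , y) ∷ R)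
  extend x y R alt short = x′ , y′ , record
    { unique-xs = All.tabulate (λ i∈ x′≡i → x′∉ (subst (_∈ _) (sym x′≡i) i∈)) ∷ Alt.unique-xs
    ; unique-ys = All.tabulate (λ j∈ y′≡j → y′∉ (subst (_∈ _) (sym y′≡j) j∈)) ∷ Alt.unique-ys
    ; walk      = ex′y′ , exy′ , Alt.walk
    ; ends-at-b = inj₁ x′ ∷ inj₂ y′ ∷ proj₁ Alt.ends-at-b
                , cong (λ vs → inj₁ x′ ∷ inj₂ y′ ∷ vs) (proj₂ Alt.ends-at-b) }
    where
    module Alt = Alternating alt
    ys = map proj₂ ((x , y) ∷ R)
    xs = map proj₁ ((x , y) ∷ R)
    few : ∀ {B : Set} (f : Fin m × Fin n → B) → length (map f ((x , y) ∷ R)) < l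
    few f = subst (_< l) (sym (cong suc (length-map f R))) short
    y-step = fresh (E x) ys (≤-trans (few proj₂) (min-deg (inj₁ x) (adj⇒deg>0 E (inj₁ x) (inj₂ y) (proj₁ Alt.walk))))
    y′ = proj₁ y-step
    exy′ = proj₁ (proj₂ y-step)
    y′∉ = proj₂ (proj₂ y-step)
    x-step = fresh (λ i → E i y′) xs
      (≤-trans (few proj₁) (min-deg (inj₂ y′) (adj⇒deg>0 E (inj₂ y′) (inj₁ x) exy′)))
    x′ = proj₁ x-step
    ex′y′ = proj₁ (proj₂ x-step)
    x′∉ = proj₂ (proj₂ x-step)

  build : ∀ t → t < l → ∃ λ x → ∃ λ y → ∃ λ R → Alternating ((x , y) ∷ R) × length R ≡ t
  build zero    _   = a , b , [] , record
    { unique-xs = [] ∷ [] ; unique-ys = [] ∷ [] ; walk = eab , tt ; ends-at-b = [ inj₁ a ] , refl } , refl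
  build (suc t) t<l with build t (≤-trans (n≤1+n _) t<l)
  ... | x , y , R , alt , refl = grow (extend x y R alt t<l)
    where
    grow : (∃ λ x′ → ∃ λ y′ → Alternating ((x′ , y′) ∷ (x , y) ∷ R)) →
           ∃ λ x′ → ∃ λ y′ → ∃ λ R′ → Alternating ((x′ , y′) ∷ R′) × length R′ ≡ suc (length R)
    grow (x′ , y′ , alt′) = x′ , y′ , (x , y) ∷ R , alt′ , refl

  block : ∀ {t} → l ≡ suc t → ClosedBlock E l
  block {t} refl = record
    { xs = xs ; ys = ys ; unique-xs = Alt.unique-xs ; unique-ys = Alt.unique-ys
    ; length-xs = trans (length-map proj₁ R₀) (cong suc length-R)
    ; length-ys = trans (length-map proj₂ R₀) (cong suc length-R)
    ; closed = closed
    ; active-xs = λ i i∈ → active (∈alternate-inj₁ R₀ (∈ᵇ⇒∈ i∈))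
    ; active-ys = λ j j∈ → active (∈alternate-inj₂ R₀ (∈ᵇ⇒∈ j∈)) }
    where
    built = build t ≤-refl
    x₀ = proj₁ built
    y₀ = proj₁ (proj₂ built)
    R  = proj₁ (proj₂ (proj₂ built))
    R₀ = (x₀ , y₀) ∷ R
    alt = proj₁ (proj₂ (proj₂ (proj₂ built)))
    length-R = proj₂ (proj₂ (proj₂ (proj₂ built)))
    module Alt = Alternating alt
    xs = map proj₁ R₀
    ys = map proj₂ R₀
    c  = alternate R₀
    unique-c = Unique-alternate R₀ Alt.unique-xs Alt.unique-ys

    long-path : ∀ {vs} → length vs ≡ suc (l + l) → Unique vs → Walk E vs → ⊥
    long-path {vs} len uvs wvs = no-path (subst (λ k → ContainsPath k E) len (walk⇒path E vs uvs wvs))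

    length-c : length c ≡ l + l
    length-c = trans (length-alternate R₀) (cong (λ k → suc k + suc k) length-R)

    neighbours-on-path : ∀ j → T (E x₀ j) → j ∈ ys
    neighbours-on-path j ex₀j with T? (j ∈ᵇ ys)
    ... | yes j∈ = ∈ᵇ⇒∈ j∈
    ... | no  j∉ = ⊥-elim (long-path (cong suc length-c)
      (All.tabulate (λ v∈ j≡v → j∉ (∈⇒∈ᵇ (inj₂∈alternate R₀ (subst (_∈ c) (sym j≡v) v∈)))) ∷ unique-c)
      (ex₀j , Alt.walk))

    ex₀b : T (E x₀ b)
    ex₀b = count≥length⇒covers (E x₀) Alt.unique-ys
      (≤-trans (≤-reflexive (trans (length-map proj₂ R₀) (cong suc length-R)))
               (min-deg (inj₁ x₀) (adj⇒deg>0 E (inj₁ x₀) (inj₂ y₀) (proj₁ Alt.walk))))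
      neighbours-on-path
      (inj₂∈alternate R₀ (subst (inj₂ b ∈_) (sym (proj₂ Alt.ends-at-b)) (∈-++⁺ʳ (proj₁ Alt.ends-at-b) (here refl))))

    cycle : Walk E (c ++ [ inj₁ x₀ ])
    cycle = subst (Walk E) (sym (trans (cong (_++ [ inj₁ x₀ ]) (proj₂ Alt.ends-at-b))
                                       (++-assoc (proj₁ Alt.ends-at-b) [ inj₂ b ] [ inj₁ x₀ ])))
      (walk-++⁺ E (proj₁ Alt.ends-at-b) (inj₂ b) [ inj₁ x₀ ]
        (subst (Walk E) (proj₂ Alt.ends-at-b) Alt.walk) (ex₀b , tt))

    enter : ∀ {z} → z ∈ c → ∃ λ rs → c ↭ z ∷ rs × Walk E (z ∷ rs)
    enter = rotate E (inj₁ x₀) (inj₂ y₀ ∷ alternate R) cycle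

    stays : ∀ {u z} → z ∈ c → Adj E u z → u ∈ c
    stays {u} z∈ uz with u ∈? c
    ... | yes u∈ = u∈
    ... | no  u∉ with enter z∈
    ...   | rs , c↭zrs , walk = ⊥-elim (long-path (cong suc (trans (sym (↭-length c↭zrs)) length-c))
      (All.tabulate (λ v∈ u≡v → u∉ (∈-resp-↭ (↭-sym c↭zrs) (subst (_∈ _) (sym u≡v) v∈)))
        ∷ Unique-resp-↭ c↭zrs unique-c)
      (uz , walk))

    active : ∀ {z} → z ∈ c → 0 < deg E z
    active {z} z∈ with enter z∈
    ... | w ∷ _ , _    , walk = adj⇒deg>0 E z w (proj₁ walk)
    ... | []    , c↭z , _    with ↭-length c↭z
    ...   | ()

    closed : Closed xs ys E
    closed i j eij (inj₁ i∈) = i∈ , ∈⇒∈ᵇ (inj₂∈alternate R₀ (stays (∈alternate-inj₁ R₀ (∈ᵇ⇒∈ i∈)) eij))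
    closed i j eij (inj₂ j∈) = ∈⇒∈ᵇ (inj₁∈alternate R₀ (stays (∈alternate-inj₂ R₀ (∈ᵇ⇒∈ j∈)) eij)) , j∈

closed-block : ∀ {m n} (E : BipGraph m n) l → 0 < l → ¬ ContainsPath (suc (l + l)) E →
  (∀ v → 0 < deg E v → l ≤ deg E v) → ∀ a b → T (E a b) → ClosedBlock E l
closed-block E (suc t) _ no-path min-deg a b eab =
  BlockConstruction.block E (suc t) no-path min-deg a b eab refl

module _ {m n : ℕ} {E : BipGraph m n} {l : ℕ} (B : ClosedBlock E l) where
  open ClosedBlock B

  edges-deleteBlock : edges E ≤ edges (delete xs ys E) + l * l
  edges-deleteBlock = ≤-trans (edges≤delete+crossing xs ys E)
    (+-monoʳ-≤ _ (≤-trans (crossing-closed xs ys E closed) (≤-reflexive (cong₂ _*_ length-xs length-ys))))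

  νX-deleteBlock : νX (delete xs ys E) + l ≤ νX E
  νX-deleteBlock = subst (λ k → νX (delete xs ys E) + k ≤ νX E) length-xs (νX-delete ys E unique-xs active-xs)

  νY-deleteBlock : νY (delete xs ys E) + l ≤ νY E
  νY-deleteBlock = subst (λ k → νY (delete xs ys E) + k ≤ νY E) length-ys (νY-delete xs E unique-ys active-ys)

  ν-deleteBlock : ν (delete xs ys E) + (l + l) ≤ ν E
  ν-deleteBlock = ≤-trans (≤-reflexive (interchange (νX (delete xs ys E)) _ l l))
                          (+-mono-≤ νX-deleteBlock νY-deleteBlock)

  νY≤deleteBlock : νY E ≤ νY (delete xs ys E) + l
  νY≤deleteBlock = ≤-trans
    (#positive-appear (_∈ᵇ ys) (λ j j∉ → degY-delete-untouched xs ys E j∉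
      (λ i eij i∈ → j∉ (proj₂ (closed i j eij (inj₁ i∈))))))
    (+-monoʳ-≤ _ (≤-trans (count-∈ᵇ≤length ys) (≤-reflexive length-ys)))

-- Graphs without a path on 2l + 1 vertices, l ≥ 3

low-vertex? : ∀ {m n} (E : BipGraph m n) d →
  (∃ λ v → 0 < deg E v × deg E v ≤ d) ⊎ (∀ v → 0 < deg E v → suc d ≤ deg E v)
low-vertex? E d with Fin.any? (λ i → (0 <? degX E i) ×-dec (degX E i ≤? d))
                   | Fin.any? (λ j → (0 <? degY E j) ×-dec (degY E j ≤? d))
... | yes (i , low) | _             = inj₁ (inj₁ i , low)
... | no _          | yes (j , low) = inj₁ (inj₂ j , low)
... | no no-low-X   | no no-low-Y   = inj₂ high
  where
  high : ∀ v → 0 < deg E v → suc d ≤ deg E v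
  high (inj₁ i) pos = ≰⇒> (λ low → no-low-X (i , pos , low))
  high (inj₂ j) pos = ≰⇒> (λ low → no-low-Y (j , pos , low))

fuel-step : ∀ {ν′ k ν fuel} → 0 < k → ν′ + k ≤ ν → ν ≤ suc fuel → ν′ ≤ fuel
fuel-step {ν′} k>0 le ν≤ = ≤-pred (<-≤-trans (m<m+n ν′ k>0) (≤-trans le ν≤))

-- Deleting a part spanning d edges and k non-isolated vertices preserves the bound.
bound-step : ∀ p {e e′ d ν′ ν k} → e ≤ e′ + d → ν′ + k ≤ ν → d ≤ p * k → d + p ≤ p * ν →
  e′ ≡ 0 ⊎ e′ + p ≤ p * ν′ → e + p ≤ p * ν
bound-step p e≤ _ _ d+p≤pν (inj₁ refl) = ≤-trans (+-monoˡ-≤ p e≤) d+p≤pν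
bound-step p {e} {e′} {d} {ν′} {ν} {k} e≤ ν′+k≤ν d≤pk _ (inj₂ ih) = begin
  e + p              ≤⟨ +-monoˡ-≤ p e≤ ⟩
  e′ + d + p         ≡⟨ xy∙z≈xz∙y e′ d p ⟩
  e′ + p + d         ≤⟨ +-mono-≤ ih d≤pk ⟩
  p * ν′ + p * k     ≡⟨ *-distribˡ-+ p ν′ k ⟨
  p * (ν′ + k)       ≤⟨ *-monoʳ-≤ p ν′+k≤ν ⟩
  p * ν              ∎
  where open ≤-Reasoning

block-cost : ∀ q → (3 + q) * (3 + q) + (2 + q) ≤ (2 + q) * ((3 + q) + (3 + q))
block-cost q = m+n≤o⇒m≤o _ (≤-reflexive (identity q))
  where
  identity : ∀ q → (3 + q) * (3 + q) + (2 + q) + (1 + 3 * q + q * q) ≡ (2 + q) * ((3 + q) + (3 + q))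
  identity = solve-∀

long-path-bound : ∀ {m n} q fuel (E : BipGraph m n) → ¬ ContainsPath (suc ((3 + q) + (3 + q))) E →
  ν E ≤ fuel → edges E ≡ 0 ⊎ edges E + (2 + q) ≤ (2 + q) * ν E
long-path-bound q zero       E no-path ν≤0 = inj₁ (ν≤0⇒edges≡0 E ν≤0)
long-path-bound q (suc fuel) E no-path ν≤fuel with edges E ≟ 0
... | yes e≡0 = inj₁ e≡0
... | no  e≢0 with edges>0⇒edge E (n≢0⇒n>0 e≢0) | low-vertex? E (2 + q)
... | a , b , eab | inj₁ (v , deg>0 , deg≤p) =
  inj₂ (bound-step p {e′ = edges (E ─ v)} {ν′ = ν (E ─ v)} (edges-─ E v) (ν-─ E v deg>0) deg≤p*1 deg+p≤pν
    (long-path-bound q fuel (E ─ v) (no-path ∘ ContainsPath-⊆ E (─-⊆ E v))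
      (fuel-step (s≤s z≤n) (ν-─ E v deg>0) ν≤fuel)))
  where
  p = 2 + q
  deg≤p*1 : deg E v ≤ p * 1
  deg≤p*1 = ≤-trans deg≤p (≤-reflexive (sym (*-identityʳ p)))
  deg+p≤pν : deg E v + p ≤ p * ν E
  deg+p≤pν = begin
    deg E v + p    ≤⟨ +-monoˡ-≤ p deg≤p ⟩
    p + p          ≡⟨ trans (*-comm p 2) (cong (p +_) (+-identityʳ p)) ⟨
    p * 2          ≤⟨ *-monoʳ-≤ p (edge⇒ν≥2 E a b eab) ⟩
    p * ν E        ∎
    where open ≤-Reasoning
... | a , b , eab | inj₂ min-deg =
  inj₂ (bound-step p {e′ = edges E′} {ν′ = ν E′} (edges-deleteBlock B) (ν-deleteBlock B)
    (m+n≤o⇒m≤o _ (block-cost q))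
    (≤-trans (block-cost q) (*-monoʳ-≤ p (m+n≤o⇒n≤o (ν E′) (ν-deleteBlock B))))
    (long-path-bound q fuel E′ (no-path ∘ ContainsPath-⊆ E (delete-⊆ xs ys E))
      (fuel-step (s≤s z≤n) (ν-deleteBlock B) ν≤fuel)))
  where
  p = 2 + q
  B : ClosedBlock E (3 + q)
  B = closed-block E (3 + q) (s≤s z≤n) no-path min-deg a b eab
  open ClosedBlock B
  E′ = delete xs ys E

long-path-free⇒edges≤ : ∀ {m n} q (E : BipGraph m n) → ¬ ContainsPath (suc ((3 + q) + (3 + q))) E →
  edges E ≤ (2 + q) * (m + n ∸ 1)
long-path-free⇒edges≤ {m} {n} q E no-path with long-path-bound q (ν E) E no-path ≤-refl
... | inj₁ e≡0 = ≤-trans (≤-reflexive e≡0) z≤n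
... | inj₂ e+p≤pν = begin
  edges E                  ≤⟨ m+n≤o⇒m≤o∸n _ (≤-trans e+p≤pν (*-monoʳ-≤ p (ν≤m+n E))) ⟩
  p * (m + n) ∸ p          ≡⟨ cong (p * (m + n) ∸_) (*-identityʳ p) ⟨
  p * (m + n) ∸ p * 1      ≡⟨ *-distribˡ-∸ p (m + n) 1 ⟨
  p * (m + n ∸ 1)          ∎
  where
  open ≤-Reasoning
  p = 2 + q

-- Graphs without P₃ or P₅

P₃-free⇒edges≤m : ∀ {m n} (E : BipGraph m n) → ¬ ContainsPath 3 E → edges E ≤ m
P₃-free⇒edges≤m {m} {n} E no-path = sum≤n degX≤1
  where
  degX≤1 : ∀ i → degX E i ≤ 1
  degX≤1 i with degX E i ≤? 1
  ... | yes ≤1 = ≤1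
  ... | no  >1 with count-witness (E i) (≤-trans (s≤s z≤n) (≰⇒> >1))
  ...   | j , eij with fresh (E i) [ j ] (≰⇒> >1)
  ...     | j′ , eij′ , j′∉ = ⊥-elim (no-path (walk⇒path E (inj₂ j ∷ inj₁ i ∷ inj₂ j′ ∷ [])
    (((λ ()) ∷ (λ j≡j′ → j′∉ (here (sym (inj₂-injective j≡j′)))) ∷ []) ∷ ((λ ()) ∷ []) ∷ [] ∷ [])
    (eij , eij′ , tt)))

-- The second alternative accounts for components isomorphic to C₄, where e = ν.
P₅Bound : ∀ {m n} → BipGraph m n → Set
P₅Bound E = edges E + 1 ≤ ν E ⊎ (edges E ≤ ν E × νY E ≤ νX E)

P₅Bound⇒edges≤ν : ∀ {m n} (E : BipGraph m n) → P₅Bound E → edges E ≤ ν E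
P₅Bound⇒edges≤ν E (inj₁ e+1≤ν)    = ≤-trans (m≤m+n (edges E) 1) e+1≤ν
P₅Bound⇒edges≤ν E (inj₂ (e≤ν , _)) = e≤ν

edgeless-P₅Bound : ∀ {m n} (E : BipGraph m n) → edges E ≡ 0 → P₅Bound E
edgeless-P₅Bound E e≡0 =
  inj₂ (≤-trans (≤-reflexive e≡0) z≤n , ≤-trans (≤-reflexive (edges≡0⇒νY≡0 E e≡0)) z≤n)

P₅Bound-step : ∀ {m n} {E′ E : BipGraph m n} k d → edges E ≤ edges E′ + k → ν E′ + k ≤ ν E →
  νX E′ + d ≤ νX E → νY E ≤ νY E′ + d → P₅Bound E′ → P₅Bound E
P₅Bound-step {E′ = E′} {E} k d e≤ ν≤ νX≤ νY≤ (inj₁ e′+1≤ν′) = inj₁ (begin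
  edges E + 1        ≤⟨ +-monoˡ-≤ 1 e≤ ⟩
  edges E′ + k + 1   ≡⟨ xy∙z≈xz∙y (edges E′) k 1 ⟩
  edges E′ + 1 + k   ≤⟨ +-monoˡ-≤ k e′+1≤ν′ ⟩
  ν E′ + k           ≤⟨ ν≤ ⟩
  ν E                ∎)
  where open ≤-Reasoning
P₅Bound-step {E′ = E′} {E} k d e≤ ν≤ νX≤ νY≤ (inj₂ (e′≤ν′ , νY′≤νX′)) =
  inj₂ ( ≤-trans e≤ (≤-trans (+-monoˡ-≤ k e′≤ν′) ν≤)
       , ≤-trans νY≤ (≤-trans (+-monoˡ-≤ d νY′≤νX′) νX≤))

X-leaf-step : ∀ {m n} (E : BipGraph m n) i → degX E i ≡ 1 → P₅Bound (E ─ inj₁ i) → P₅Bound E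
X-leaf-step E i leaf = P₅Bound-step {E′ = E ─ inj₁ i} 1 1
  (subst (λ d → edges E ≤ edges (E ─ inj₁ i) + d) leaf (edges-─ E (inj₁ i)))
  (ν-─ E (inj₁ i) deg>0) (νX-─ E i deg>0) νY≤
  where
  deg>0 : 0 < degX E i
  deg>0 = ≤-reflexive (sym leaf)
  νY≤ : νY E ≤ νY (E ─ inj₁ i) + 1
  νY≤ = subst (λ d → νY E ≤ νY (E ─ inj₁ i) + d) leaf (#positive-appear (E i)
    (λ j ¬eij → degY-delete-untouched [ i ] [] E (λ ())
      (λ i′ ei′j i′∈ → ¬eij (subst (λ k → T (E k j)) (∈ᵇ[ i ] i′∈) ei′j))))

≢1⇒≥2 : ∀ {d} → 0 < d → d ≢ 1 → 2 ≤ d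
≢1⇒≥2 {suc zero}    _ d≢1 = ⊥-elim (d≢1 refl)
≢1⇒≥2 {suc (suc d)} _ _   = s≤s (s≤s z≤n)

-- Otherwise j x j′ i j″ is a P₅, where j″ is a second neighbour of i.
pendant-star : ∀ {m n} (E : BipGraph m n) → ¬ ContainsPath 5 E → (∀ i → degX E i ≢ 1) →
  ∀ {j x} → degY E j ≡ 1 → T (E x j) → ∀ {j′ i} → T (E x j′) → T (E i j′) → i ≡ x
pendant-star E no-path no-X-leaf {j} {x} leaf exj {j′} {i} exj′ eij′ with i Fin.≟ x
... | yes i≡x = i≡x
... | no  i≢x = ⊥-elim (no-path (walk⇒path E (inj₂ j ∷ inj₁ x ∷ inj₂ j′ ∷ inj₁ i ∷ inj₂ j″ ∷ [])
    (  ((λ ()) ∷ j≢ j′≢j ∷ (λ ()) ∷ j≢ j″≢j ∷ [])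
     ∷ ((λ ()) ∷ (i≢x ∘ sym ∘ inj₁-injective) ∷ (λ ()) ∷ [])
     ∷ ((λ ()) ∷ (λ eq → j″∉ (here (sym (inj₂-injective eq)))) ∷ [])
     ∷ ((λ ()) ∷ []) ∷ [] ∷ [])
    (exj , exj′ , eij′ , eij″ , tt)))
  where
  only-x : ∀ {i} → T (E i j) → i ≡ x
  only-x eij = count≤1⇒unique (λ i → E i j) (≤-reflexive leaf) eij exj
  j≢ : ∀ {k} → k ≢ j → inj₂ j ≢ inj₂ k
  j≢ k≢j eq = k≢j (sym (inj₂-injective eq))
  j′≢j : j′ ≢ j
  j′≢j refl = i≢x (only-x eij′)
  i-step = fresh (E i) [ j′ ] (≢1⇒≥2 (witness⇒count>0 (E i) j′ eij′) (no-X-leaf i))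
  j″ = proj₁ i-step
  eij″ = proj₁ (proj₂ i-step)
  j″∉ = proj₂ (proj₂ i-step)
  j″≢j : j″ ≢ j
  j″≢j refl = i≢x (only-x eij″)

-- Deleting the centre of such a star removes deg x edges but 1 + deg x vertices.
star-step : ∀ {m n} (E : BipGraph m n) x → 0 < degX E x →
  (∀ {j′ i} → T (E x j′) → T (E i j′) → i ≡ x) → P₅Bound (E ─ inj₁ x) → edges E + 1 ≤ ν E
star-step E x deg>0 star bound = begin
  edges E + 1                              ≤⟨ +-monoˡ-≤ 1 (edges-─ E (inj₁ x)) ⟩
  edges E′ + d + 1                         ≤⟨ +-monoˡ-≤ 1 (+-monoˡ-≤ d (P₅Bound⇒edges≤ν E′ bound)) ⟩
  νX E′ + νY E′ + d + 1                    ≡⟨ rearrange (νX E′) (νY E′) d ⟩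
  (νX E′ + 1) + (νY E′ + d)                ≤⟨ +-mono-≤ (νX-─ E x deg>0) νY-star ⟩
  νX E + νY E                              ∎
  where
  open ≤-Reasoning
  E′ = E ─ inj₁ x
  d = degX E x
  rearrange : ∀ a b c → a + b + c + 1 ≡ a + 1 + (b + c)
  rearrange = solve-∀
  νY-star : νY E′ + d ≤ νY E
  νY-star = #positive-vanish (E x) (λ j → count-mono (λ i → delete-⊆ [ x ] [] E i j))
    (λ j exj → isolated j exj , witness⇒count>0 (λ i → E i j) x exj)
    where
    isolated : ∀ j → T (E x j) → degY E′ j ≡ 0
    isolated j exj = count-none gone
      where
      gone : ∀ i → ¬ T (E i j ∧ not (i ∈ᵇ [ x ] ∨ j ∈ᵇ []))
      gone i t = T-not⇒¬T (∧-elimʳ t)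
        (Equivalence.from (T-∨ {y = j ∈ᵇ []}) (inj₁ (∈⇒∈ᵇ {L = [ x ]} (here (star exj (∧-elimˡ t))))))

P₅-free-bound : ∀ {m n} fuel (E : BipGraph m n) → ¬ ContainsPath 5 E → ν E ≤ fuel → P₅Bound E
P₅-free-bound zero       E no-path ν≤0 = edgeless-P₅Bound E (ν≤0⇒edges≡0 E ν≤0)
P₅-free-bound (suc fuel) E no-path ν≤fuel with edges E ≟ 0
... | yes e≡0 = edgeless-P₅Bound E e≡0
... | no  e≢0 with edges>0⇒edge E (n≢0⇒n>0 e≢0) | Fin.any? (λ i → degX E i ≟ 1) | Fin.any? (λ j → degY E j ≟ 1)
... | _ | yes (i , leaf) | _ = X-leaf-step E i leaf
    (P₅-free-bound fuel (E ─ inj₁ i) (no-path ∘ ContainsPath-⊆ E (─-⊆ E (inj₁ i)))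
      (fuel-step (s≤s z≤n) (ν-─ E (inj₁ i) (≤-reflexive (sym leaf))) ν≤fuel))
... | _ | no no-X-leaf | yes (j , leaf) = inj₁ (star-step E x (witness⇒count>0 (E x) j exj)
    (pendant-star E no-path (λ i eq → no-X-leaf (i , eq)) leaf exj)
    (P₅-free-bound fuel (E ─ inj₁ x) (no-path ∘ ContainsPath-⊆ E (─-⊆ E (inj₁ x)))
      (fuel-step (s≤s z≤n) (ν-─ E (inj₁ x) (witness⇒count>0 (E x) j exj)) ν≤fuel)))
  where
  neighbour = count-witness (λ i → E i j) (≤-reflexive (sym leaf))
  x = proj₁ neighbour
  exj = proj₂ neighbour
... | a , b , eab | no no-X-leaf | no no-Y-leaf =
  P₅Bound-step {E′ = delete xs ys E} 4 2 (edges-deleteBlock B) (ν-deleteBlock B) (νX-deleteBlock B) (νY≤deleteBlock B)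
    (P₅-free-bound fuel (delete xs ys E) (no-path ∘ ContainsPath-⊆ E (delete-⊆ xs ys E))
      (fuel-step (s≤s z≤n) (ν-deleteBlock B) ν≤fuel))
  where
  min-deg : ∀ v → 0 < deg E v → 2 ≤ deg E v
  min-deg (inj₁ i) pos = ≢1⇒≥2 pos (λ eq → no-X-leaf (i , eq))
  min-deg (inj₂ j) pos = ≢1⇒≥2 pos (λ eq → no-Y-leaf (j , eq))
  B : ClosedBlock E 2
  B = closed-block E 2 (s≤s z≤n) no-path min-deg a b eab
  open ClosedBlock B

P₅-free⇒edges≤m+n∸1 : ∀ {m n} (E : BipGraph m n) → m < n → ¬ ContainsPath 5 E → edges E ≤ m + n ∸ 1
P₅-free⇒edges≤m+n∸1 {m} {n} E m<n no-path with P₅-free-bound (ν E) E no-path ≤-refl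
... | inj₁ e+1≤ν = m+n≤o⇒m≤o∸n _ (≤-trans e+1≤ν (ν≤m+n E))
... | inj₂ (e≤ν , νY≤νX) = m+n≤o⇒m≤o∸n _ (begin
  edges E + 1         ≤⟨ +-monoˡ-≤ 1 e≤ν ⟩
  νX E + νY E + 1     ≤⟨ +-monoˡ-≤ 1 (+-mono-≤ νX≤m (≤-trans νY≤νX νX≤m)) ⟩
  m + m + 1           ≡⟨ +-assoc m m 1 ⟩
  m + (m + 1)         ≤⟨ +-monoʳ-≤ m (≤-trans (≤-reflexive (+-comm m 1)) m<n) ⟩
  m + n               ∎)
  where
  open ≤-Reasoning
  νX≤m : νX E ≤ m
  νX≤m = count≤n (positive ∘ degX E)

path-free⇒edges≤ : ∀ {m n} l → 0 < l → m < n → (E : BipGraph m n) → ¬ ContainsPath (suc (l + l)) E →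
  edges E ≤ m ⊔ ((l ∸ 1) * (m + n ∸ 1))
path-free⇒edges≤ 1 _ _ E no-path = ≤-trans (P₃-free⇒edges≤m E no-path) (m≤m⊔n _ _)
path-free⇒edges≤ 2 _ m<n E no-path =
  ≤-trans (P₅-free⇒edges≤m+n∸1 E m<n no-path) (≤-trans (≤-reflexive (sym (*-identityˡ _))) (m≤n⊔m _ _))
path-free⇒edges≤ (suc (suc (suc q))) _ _ E no-path = ≤-trans (long-path-free⇒edges≤ q E no-path) (m≤n⊔m _ _)

k≤1+2⌊k/2⌋ : ∀ k → k ≤ suc (k / 2 + k / 2)
k≤1+2⌊k/2⌋ k = begin
  k                      ≡⟨ m≡m%n+[m/n]*n k 2 ⟩
  k % 2 + k / 2 * 2      ≤⟨ +-mono-≤ (≤-pred (m%n<n k 2)) (≤-reflexive (*-comm (k / 2) 2)) ⟩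
  1 + 2 * (k / 2)        ≡⟨ cong suc (cong (k / 2 +_) (+-identityʳ (k / 2))) ⟩
  suc (k / 2 + k / 2)    ∎
  where open ≤-Reasoning

-- N = m + 1; the hypothesis m ≤ n is then implied.
corollary1p1 : (k : ℕ) → 2 ≤ k → (m : ℕ) →
    Σ ℕ λ N → (n : ℕ) → n ≥ N → m ≤ n →
      (E : BipGraph m n) → ¬ ContainsPath k E →
        edgeCount E ≤ m ⊔ ((k / 2 ∸ 1) * (m + n ∸ 1))
corollary1p1 k 2≤k m = suc m , λ n m<n _ E no-Pₖ → begin
  edgeCount E                          ≡⟨ edgeCount≡edges E ⟩
  edges E                              ≤⟨ path-free⇒edges≤ (k / 2) (m≥n⇒m/n>0 2≤k) m<n E
                                            (no-Pₖ ∘ ContainsPath-≤ E (k≤1+2⌊k/2⌋ k)) ⟩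
  m ⊔ ((k / 2 ∸ 1) * (m + n ∸ 1))      ∎
  where open ≤-Reasoning
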